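{- Let $(G,\rho)$ be a reduced maximal Gallai multigraph with vertex set $\mathcal V$, $H$ an induced subgraph of $G$, and suppose $H$ has the tree property for $n$. Let $U\in\mathcal V_{n+1}$ and let $v\in\mathcal V$ (a vertex of $G$, not necessarily of $H$) be such that $\rho[\mathrm{brt}(U)\,v]=\{C\}$ for a color $C\notin\mathrm{tc}(U)$. Then $\rho[Uv]=\{C\}$.
   Context: An edge-colored (complete, loopless) multigraph $(G,\rho)$ has a finite vertex set $\mathcal V\subseteq\mathbb N$, ordered by the usual order of $\mathbb N$, and assigns to each unordered pair of distinct vertices $u,v$ a nonempty finite set $\rho[uv]$ of colors (parallel edges have distinct colors). For vertex sets $U,W$ let $\rho[UW]=\bigcup\{\rho[uw]:u\in U,w\in W,u\ne w\}$; a single vertex $u$ is identified with $\{u\}$. Three distinct vertices form a rainbow triangle if one can pick pairwise distinct colors from the three color sets of its sides. $(G,\rho)$ is Gallai if it has no rainbow triangle; maximal if for every pair $u,v$ and color $B\notin\rho[uv]$, adding $B$ to $\rho[uv]$ would create a rainbow triangle; reduced if there is no pair $u,v$ with $\rho[uw]=\rho[vw]$ and $|\rho[uw]|=1$ for all $w\notin\{u,v\}$. Dominance: for disjoint nonempty $U,V\subseteq\mathcal V$, $U\triangleright V$ iff $|\rho[UV]|>1$ and either (a) $U=\{u\}$, $V=\{v\}$, $u<v$, or (b) $|U|>1$ or $|V|>1$, and $\rho[uv]=\rho[uV]$ for all $u\in U,v\in V$. The signature $\Sigma(U,V)$ is the map $u\mapsto\rho[uV]$ on $U$. Mixed graphs: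 complete means each pair of distinct vertices is joined by exactly one edge, undirected or directed (one direction). Weak components are the components of the graph given by the directed edges with directions forgotten (undirected edges ignored). A rooted tree is a transitive directed graph whose transitive reduction is a tree; its root is the unique vertex with a directed edge to every other vertex. For an induced subgraph $H$ define $M_n(H)=(\mathcal V_n,\mathcal E_n,\mathcal A_n)$: $\mathcal V_0=V(H)$, $\mathcal A_0=\{(u,v):u\triangleright v\}$, $\mathcal E_0=\{\{u,v\}:|\rho[uv]|=1\}$; for $n\ge1$, $\mathcal V_n$ is the partition of $V(H)$ whose blocks are the unions of the members of $\mathcal V_{n-1}$ lying in one weak component of $M_{n-1}(H)$, $\mathcal A_n=\{(U,W)\in\mathcal V_n^2:U\triangleright W\}$, $\mathcal E_n=\{\{U,W\}:U\neq W,\ |\rho[UW]|=1\}$. $H$ has the tree property for $n$ if for every $k\le n$: $M_k(H)$ is complete; $|\rho[UW]|=1$ on $\mathcal E_k$ and $=2$ on $\mathcal A_k$; every weak component of $M_k(H)$ with its directed edges is a rooted tree; and $(U,V),(V,W)\in\mathcal A_k$ implies $\Sigma(U,V)=\Sigma(U,W)$. Root notation (given the tree property for $n$): for $1\le k\le n+1$ and $U\in\mathcal V_k$, $\mathrm{tr}(U)$ is the set of members of $\mathcal V_{k-1}$ contained in $U$ (a weak component of $M_{k-1}(H)$) and $\mathrm{rt}(U)\in\mathcal V_{k-1}$ is its root. Iterating $\mathrm{rt}$ down to level $0$ yields a single vertex $\mathrm{brt}(U)$ (for $U=\{u\}\in\mathcal V_0$, $\mathrm{brt}(U)=u$). Tree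 colors: for $u\in\mathcal V_0$, $\mathrm{tc}(u)=\bigcup\{\rho[uv]:v\in V(H),\ u\triangleright v\}$; for $U\in\mathcal V_k$ with $k\ge1$, $\mathrm{tc}(U)=\mathrm{tc}(\mathrm{rt}(U))$. -}

module Defs where

open import Data.Nat using (ℕ; zero; suc; _<_; _≤_)
open import Data.List using (List; []; _∷_; _++_; take; length)
open import Data.List.Membership.Propositional using (_∈_; _∉_)
open import Data.List.Relation.Unary.All using (All)
open import Data.List.Relation.Unary.AllPairs using (AllPairs)
open import Data.List.Relation.Unary.Linked using (Linked)
open import Data.Product using (Σ; ∃; ∃-syntax; _×_; _,_)
open import Data.Sum using (_⊎_)
open import Data.Empty using (⊥)
open import Relation.Nullary using (¬_)
open import Relation.Binary.PropositionalEquality using (_≡_; _≢_)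
open import Relation.Binary.Construct.Closure.ReflexiveTransitive using (Star)

-- Conventions
--  * vertices and colours are natural numbers;
--  * a vertex set is a (finite) list of naturals (membership is what matters);
--  * an edge colouring is ρ : ℕ → ℕ → List ℕ; ρ u v (for distinct vertices)
--    is the finite colour set ρ[uv] (list read as a set);
--  * sets of vertices / colours are predicates  ℕ → Set.

VSet : Set₁
VSet = ℕ → Set

CSet : Set₁
CSet = ℕ → Set

Colouring : Set
Colouring = ℕ → ℕ → List ℕ

_≐_ : (ℕ → Set) → (ℕ → Set) → Set
S ≐ T = ∀ x → (S x → T x) × (T x → S x)

｛_｝ : ℕ → (ℕ → Set)
｛ a ｝ = λ x → x ≡ a

One : (ℕ → Set) → Set
One S = ∃[ a ] (S ≐ ｛ a ｝)

MoreThanOne : (ℕ → Set) → Set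
MoreThanOne S = ∃[ a ] ∃[ b ] (S a × S b × a ≢ b)

ExactlyTwo : (ℕ → Set) → Set
ExactlyTwo S = ∃[ a ] ∃[ b ] (a ≢ b × (∀ x → (S x → (x ≡ a ⊎ x ≡ b)) × ((x ≡ a ⊎ x ≡ b) → S x)))

EdgeColoured : List ℕ → Colouring → Set
EdgeColoured V ρ =
  ∀ u v → u ∈ V → v ∈ V → u ≢ v →
    (∃[ c ] (c ∈ ρ u v)) × (∀ c → c ∈ ρ u v → c ∈ ρ v u)

RainbowTriangle : List ℕ → (ℕ → ℕ → ℕ → Set) → Set
RainbowTriangle V Col =
  ∃[ a ] ∃[ b ] ∃[ c ]
    (a ∈ V × b ∈ V × c ∈ V × a ≢ b × b ≢ c × a ≢ c ×
     ∃[ x ] ∃[ y ] ∃[ z ]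
       (Col a b x × Col b c y × Col a c z × x ≢ y × y ≢ z × x ≢ z))

colOf : Colouring → ℕ → ℕ → ℕ → Set
colOf ρ x y c = c ∈ ρ x y

Gallai : List ℕ → Colouring → Set
Gallai V ρ = ¬ RainbowTriangle V (colOf ρ)

-- colour membership after adding colour B to the pair {u,v}
addColour : Colouring → ℕ → ℕ → ℕ → ℕ → ℕ → ℕ → Set
addColour ρ u v B x y c = c ∈ ρ x y ⊎ (c ≡ B × ((x ≡ u × y ≡ v) ⊎ (x ≡ v × y ≡ u)))

Maximal : List ℕ → Colouring → Set
Maximal V ρ =
  ∀ u v → u ∈ V → v ∈ V → u ≢ v → ∀ B → B ∉ ρ u v →
    RainbowTriangle V (addColour ρ u v B)

Reduced : List ℕ → Colouring → Set
Reduced V ρ =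
  ¬ (∃[ u ] ∃[ v ] (u ∈ V × v ∈ V × u ≢ v ×
      (∀ w → w ∈ V → w ≢ u → w ≢ v →
         ((λ c → c ∈ ρ u w) ≐ (λ c → c ∈ ρ v w)) × One (λ c → c ∈ ρ u w))))

col[_,_,_] : Colouring → VSet → VSet → CSet
col[ ρ , U , W ] c = ∃[ u ] ∃[ w ] (U u × W w × u ≢ w × c ∈ ρ u w)

IsSingleton : VSet → ℕ → Set
IsSingleton U u = U ≐ ｛ u ｝

Dom : Colouring → VSet → VSet → Set
Dom ρ U V =
  (∀ x → U x → V x → ⊥) ×
  MoreThanOne col[ ρ , U , V ] ×
  ( (∃[ u ] ∃[ v ] (IsSingleton U u × IsSingleton V v × u < v))
  ⊎ ((MoreThanOne U ⊎ MoreThanOne V) ×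
     (∀ u v → U u → V v → col[ ρ , ｛ u ｝ , ｛ v ｝ ] ≐ col[ ρ , ｛ u ｝ , V ])))

-- The levels M_k(H) of an induced subgraph H with vertex list VH.
-- Same k u w : u and w lie in the same block of the partition 𝒱_k.
-- Blk k u     : the block of 𝒱_k containing u (for u ∈ VH); every member
--               of 𝒱_k is of this form.

module Levels (ρ : Colouring) (VH : List ℕ) where

  Same : ℕ → ℕ → ℕ → Set
  Blk  : ℕ → ℕ → VSet

  -- one step in the weak-component relation of M_k(H):
  -- stay in the same block, or follow a directed edge (either direction)
  Step : ℕ → ℕ → ℕ → Set
  Step k x y = x ∈ VH × y ∈ VH ×
    (Same k x y ⊎ Dom ρ (Blk k x) (Blk k y) ⊎ Dom ρ (Blk k y) (Blk k x))

  Same zero    u w = u ≡ w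
  Same (suc k) u w = Star (Step k) u w

  Blk k u w = w ∈ VH × Same k u w

  Arc : ℕ → ℕ → ℕ → Set
  Arc k u w = Dom ρ (Blk k u) (Blk k w)

  Hasse : ℕ → ℕ → ℕ → Set
  Hasse k u w = Arc k u w × ¬ (∃[ v ] (v ∈ VH × Arc k u v × Arc k v w))

  HAdj : ℕ → ℕ → ℕ → Set
  HAdj k u w = Hasse k u w ⊎ Hasse k w u

  InComp : ℕ → ℕ → ℕ → Set
  InComp k c u = u ∈ VH × Same (suc k) c u

  Cycle : ℕ → ℕ → List ℕ → Set
  Cycle k c xs =
    3 ≤ length xs ×
    All (InComp k c) xs ×
    AllPairs (λ a b → ¬ Same k a b) xs ×
    Linked (HAdj k) (xs ++ take 1 xs)

  RootedTree : ℕ → ℕ → Set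
  RootedTree k c =
    (∀ u v w → InComp k c u → InComp k c v → InComp k c w →
       Arc k u v → Arc k v w → Arc k u w) ×
    (∀ u w → InComp k c u → InComp k c w →
       Star (λ a b → Same k a b ⊎ HAdj k a b) u w) ×
    (∀ xs → ¬ Cycle k c xs) ×
    (∃[ r ] (InComp k c r ×
       (∀ w → InComp k c w → ¬ Same k r w → Arc k r w)))

  TreeLevel : ℕ → Set
  TreeLevel k =
    (∀ u w → u ∈ VH → w ∈ VH → ¬ Same k u w →
       (One col[ ρ , Blk k u , Blk k w ] ⊎ Arc k u w ⊎ Arc k w u) ×
       ¬ (Arc k u w × Arc k w u)) ×
    -- |ρ[UW]| = 1 on ℰ_k (holds by definition of ℰ_k) and = 2 on 𝒜_k
    (∀ u w → u ∈ VH → w ∈ VH → Arc k u w → ExactlyTwo col[ ρ , Blk k u , Blk k w ]) ×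
    (∀ c → c ∈ VH → RootedTree k c) ×
    (∀ u v w → u ∈ VH → v ∈ VH → w ∈ VH → Arc k u v → Arc k v w →
       ∀ x → Blk k u x →
         col[ ρ , ｛ x ｝ , Blk k v ] ≐ col[ ρ , ｛ x ｝ , Blk k w ])

  TreeProperty : ℕ → Set
  TreeProperty n = ∀ k → k ≤ n → TreeLevel k

  -- r represents rt(U) ∈ 𝒱_k, where U ∈ 𝒱_{k+1} is the block of u
  IsRoot : ℕ → ℕ → ℕ → Set
  IsRoot k r u =
    r ∈ VH × Same (suc k) u r ×
    (∀ w → w ∈ VH → Same (suc k) u w → ¬ Same k r w → Arc k r w)

  IsBrt : ℕ → ℕ → ℕ → Set
  IsBrt zero    u x = x ≡ u
  IsBrt (suc k) u x = ∃[ r ] (IsRoot k r u × IsBrt k r x)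

  TC : ℕ → ℕ → CSet
  TC zero    u c = ∃[ v ] (v ∈ VH × Arc zero u v × c ∈ ρ u v)
  TC (suc k) u c = ∃[ r ] (IsRoot k r u × TC k r c)

module Submission where

open import Defs
open import Data.Nat using (ℕ; zero; suc; _<_; _≤_; _≟_)
open import Data.Nat.Properties using (<-cmp; ≤-trans; n≤1+n; ≤-pred; ≤-refl)
open import Data.List using (List)
open import Data.List.Membership.Propositional using (_∈_)
open import Data.List.Relation.Binary.Subset.Propositional using (_⊆_)
open import Data.Product using (∃-syntax; _×_; _,_; proj₁; proj₂)
open import Data.Sum using (_⊎_; inj₁; inj₂; swap)
open import Data.Empty using (⊥; ⊥-elim)
open import Relation.Nullary using (¬_; yes; no)
open import Relation.Nullary.Decidable using (decidable-stable)
open import Relation.Binary using (tri<; tri≈; tri>)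
open import Relation.Binary.PropositionalEquality using (_≡_; _≢_; refl; sym; trans; subst)
open import Relation.Binary.Construct.Closure.ReflexiveTransitive using (ε; _◅_; _◅◅_)

-- Let x = brt(U) and C ∉ tc(x), with ρ[xv] = {C}.  The heart of the proof is a simultaneous
-- induction on the level i ≤ n of two statements about blocks R ∈ 𝒱_i whose
-- bottom root is x:
--   (arcs)  every colour of an arc R ▷ Y of M_i differs from C;
--   (fans)  if a vertex w outside R sees x in one colour e and R in exactly
--           the colours e ≠ f, then C ∉ {e, f}.
-- Arcs at level 0 carry tree colours of x; fans at level i+1 reduce to fans
-- and arcs at level i through the root of the block (non-rainbow triangles),
-- and arcs at level i+1 are fans over their tail seen from the head's vertex.
-- Finally, induction along the chain of roots U ⊇ rt(U) ⊇ … ⊇ {x} shows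
-- that every block containing x avoids v and sees v in colour C only: an
-- edge wv of another colour, with w outside the root block, would close a
-- rainbow triangle with an arc colour (≠ C) from the root block to w.

Pair : ℕ → ℕ → ℕ → Set
Pair e f c = c ≡ e ⊎ c ≡ f

-- Case analysis on an arbitrary proposition is admissible for negative goals.
cases-¬ : {P B : Set} → (P → ¬ B) → (¬ P → ¬ B) → ¬ B
cases-¬ inside outside b = outside (λ p → inside p b) b

pair-cover : ∀ {e f c₁ c₂ d} → c₁ ≢ c₂ → Pair e f c₁ → Pair e f c₂ → Pair e f d → Pair c₁ c₂ d
pair-cover c₁≢c₂ (inj₁ refl) (inj₁ refl) _ = ⊥-elim (c₁≢c₂ refl)
pair-cover c₁≢c₂ (inj₁ refl) (inj₂ refl) d = d
pair-cover c₁≢c₂ (inj₂ refl) (inj₁ refl) d = swap d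
pair-cover c₁≢c₂ (inj₂ refl) (inj₂ refl) _ = ⊥-elim (c₁≢c₂ refl)

two-partner : ∀ {S : CSet} → ExactlyTwo S → ∀ {e} → S e →
  ∃[ f ] (e ≢ f × S f × (∀ z → S z → Pair e f z))
two-partner (a , b , a≢b , spec) {e} Se with proj₁ (spec e) Se
... | inj₁ refl = b , a≢b , proj₂ (spec b) (inj₂ refl) , λ z Sz → proj₁ (spec z) Sz
... | inj₂ refl = a , (λ b≡a → a≢b (sym b≡a)) , proj₂ (spec a) (inj₁ refl) ,
                  λ z Sz → swap (proj₁ (spec z) Sz)

two-other : ∀ {S : CSet} → ExactlyTwo S → ∀ c → ∃[ g ] (S g × g ≢ c)
two-other (a , b , a≢b , spec) c with a ≟ c
... | no a≢c = a , proj₂ (spec a) (inj₁ refl) , a≢c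
... | yes refl = b , proj₂ (spec b) (inj₂ refl) , λ b≡a → a≢b (sym b≡a)

-- Under P ▷ Q each p ∈ P sees all of Q in the same colours, so a colour of
-- some edge p q' lies on every edge p q with q ∈ Q.
dom-colour : ∀ {ρ} {P Q : VSet} {p q q' c} → Dom ρ P Q → P p → Q q → Q q' → p ≢ q' →
  c ∈ ρ p q' → c ∈ ρ p q
dom-colour (_ , _ , inj₁ (_ , _ , _ , Q≐q₀ , _)) _ Qq Qq' _ c∈
  with proj₁ (Q≐q₀ _) Qq | proj₁ (Q≐q₀ _) Qq'
... | refl | refl = c∈
dom-colour {p = p} {q} {c = c} (_ , _ , inj₂ (_ , signature)) Pp Qq Qq' p≢q' c∈
  with proj₂ (signature p q Pp Qq c) (p , _ , refl , Qq' , p≢q' , c∈)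
... | (_ , _ , refl , refl , _ , c∈pq) = c∈pq

module LevelFacts (ρ : Colouring) (VH : List ℕ) where
  open Levels ρ VH

  Same-refl : ∀ k a → Same k a a
  Same-refl zero a = refl
  Same-refl (suc k) a = ε

  Same-trans : ∀ k {a b c} → Same k a b → Same k b c → Same k a c
  Same-trans zero = trans
  Same-trans (suc k) = _◅◅_

  Same-suc : ∀ k {a b} → a ∈ VH → b ∈ VH → Same k a b → Same (suc k) a b
  Same-suc k a∈ b∈ s = (a∈ , b∈ , inj₁ s) ◅ ε

  Same-from-1 : ∀ i {a b} → a ∈ VH → b ∈ VH → Same 1 a b → Same (suc i) a b
  Same-from-1 zero _ _ s = s
  Same-from-1 (suc i) a∈ b∈ s = Same-suc (suc i) a∈ b∈ (Same-from-1 i a∈ b∈ s)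

  self∈Blk : ∀ k {a} → a ∈ VH → Blk k a a
  self∈Blk k a∈ = a∈ , Same-refl k _

  root⊆Blk : ∀ {k r u p} → IsRoot k r u → Blk k r p → Blk (suc k) u p
  root⊆Blk {k} (r∈ , s , _) (p∈ , sp) = p∈ , (s ◅◅ Same-suc k r∈ p∈ sp)

  brt∈Blk : ∀ k {u x} → u ∈ VH → IsBrt k u x → Blk k u x
  brt∈Blk zero u∈ refl = self∈Blk zero u∈
  brt∈Blk (suc k) u∈ (r , root , brt-r) = root⊆Blk root (brt∈Blk k (proj₁ root) brt-r)

  root-arc : ∀ {k r u w} → IsRoot k r u → Blk (suc k) u w → ¬ Same k r w → Arc k r w
  root-arc (_ , _ , dominates) (w∈ , s) ns = dominates _ w∈ s ns

  arc-disjoint : ∀ {k a b z} → Arc k a b → Blk k a z → Blk k b z → ⊥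
  arc-disjoint arc za zb = proj₁ arc _ za zb

  arc-distinct : ∀ {k a b p q} → Arc k a b → Blk k a p → Blk k b q → p ≢ q
  arc-distinct arc pB qB refl = arc-disjoint arc pB qB

  tc-lift : ∀ k {u x c} → IsBrt k u x → TC 0 x c → TC k u c
  tc-lift zero refl t = t
  tc-lift (suc k) (r , root , brt-r) t = r , root , tc-lift k brt-r t

module Proof (VG : List ℕ) (ρ : Colouring) (EC : EdgeColoured VG ρ) (gal : Gallai VG ρ)
             (VH : List ℕ) (VH⊆VG : VH ⊆ VG) where
  open Levels ρ VH
  open LevelFacts ρ VH

  colour-exists : ∀ {a b} → a ∈ VG → b ∈ VG → a ≢ b → ∃[ c ] (c ∈ ρ a b)
  colour-exists {a} {b} a∈ b∈ a≢b = proj₁ (EC a b a∈ b∈ a≢b)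

  colour-sym : ∀ {a b c} → a ∈ VH → b ∈ VH → a ≢ b → c ∈ ρ a b → c ∈ ρ b a
  colour-sym {a} {b} {c} a∈ b∈ a≢b = proj₂ (EC a b (VH⊆VG a∈) (VH⊆VG b∈) a≢b) c

  no-rainbow : ∀ {a b c X Y Z} → a ∈ VG → b ∈ VG → c ∈ VG → a ≢ b → b ≢ c → a ≢ c →
    X ∈ ρ a b → Y ∈ ρ b c → Z ∈ ρ a c → X ≢ Y → Y ≢ Z → X ≢ Z → ⊥
  no-rainbow {a} {b} {c} {X} {Y} {Z} a∈ b∈ c∈ ab bc ac X∈ Y∈ Z∈ XY YZ XZ =
    gal (a , b , c , a∈ , b∈ , c∈ , ab , bc , ac , X , Y , Z , X∈ , Y∈ , Z∈ , XY , YZ , XZ)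

  non-rainbow : ∀ {a b c X Y Z} → a ∈ VG → b ∈ VG → c ∈ VG → a ≢ b → b ≢ c → a ≢ c →
    X ∈ ρ a b → Y ∈ ρ b c → Z ∈ ρ a c → X ≡ Y ⊎ Y ≡ Z ⊎ X ≡ Z
  non-rainbow {X = X} {Y} {Z} a∈ b∈ c∈ ab bc ac X∈ Y∈ Z∈ with X ≟ Y | Y ≟ Z | X ≟ Z
  ... | yes XY | _ | _ = inj₁ XY
  ... | no _ | yes YZ | _ = inj₂ (inj₁ YZ)
  ... | no _ | no _ | yes XZ = inj₂ (inj₂ XZ)
  ... | no XY | no YZ | no XZ = ⊥-elim (no-rainbow a∈ b∈ c∈ ab bc ac X∈ Y∈ Z∈ XY YZ XZ)

  singleton-arc : ∀ {a b c c'} → a ∈ VH → b ∈ VH → a ≢ b → c ≢ c' → c ∈ ρ a b → c' ∈ ρ a b →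
    a < b → Arc 0 a b
  singleton-arc {a} {b} {c} {c'} a∈ b∈ a≢b c≢c' c∈ c'∈ a<b =
    (λ { _ (_ , refl) (_ , refl) → a≢b refl }) ,
    (c , c' , (a , b , self∈Blk 0 a∈ , self∈Blk 0 b∈ , a≢b , c∈) ,
              (a , b , self∈Blk 0 a∈ , self∈Blk 0 b∈ , a≢b , c'∈) , c≢c') ,
    inj₁ (a , b , singleton a∈ , singleton b∈ , a<b)
    where
    singleton : ∀ {z} → z ∈ VH → IsSingleton (Blk 0 z) z
    singleton z∈ _ = (λ { (_ , refl) → refl }) , (λ { refl → z∈ , refl })

  two-colours⇒step : ∀ {a b c c'} → a ∈ VH → b ∈ VH → a ≢ b → c ≢ c' → c ∈ ρ a b → c' ∈ ρ a b →
    Step 0 a b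
  two-colours⇒step {a} {b} a∈ b∈ a≢b c≢c' c∈ c'∈ with <-cmp a b
  ... | tri< a<b _ _ = a∈ , b∈ , inj₂ (inj₁ (singleton-arc a∈ b∈ a≢b c≢c' c∈ c'∈ a<b))
  ... | tri≈ _ a≡b _ = ⊥-elim (a≢b a≡b)
  ... | tri> _ _ b<a = a∈ , b∈ , inj₂ (inj₂ (singleton-arc b∈ a∈ (λ b≡a → a≢b (sym b≡a)) c≢c'
                         (colour-sym a∈ b∈ a≢b c∈) (colour-sym a∈ b∈ a≢b c'∈) b<a))

  mono-across : ∀ i {a b c c'} → a ∈ VH → b ∈ VH → ¬ Same (suc i) a b →
    c ∈ ρ a b → c' ∈ ρ a b → c ≡ c'
  mono-across i {a} {b} {c} {c'} a∈ b∈ ns c∈ c'∈ = decidable-stable (c ≟ c') λ c≢c' →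
    ns (Same-from-1 i a∈ b∈ (two-colours⇒step a∈ b∈ a≢b c≢c' c∈ c'∈ ◅ ε))
    where
    a≢b : a ≢ b
    a≢b refl = ns (Same-refl (suc i) a)

  module Avoidance (n : ℕ) (tp : TreeProperty n) (x C : ℕ) (C∉tc : ¬ TC 0 x C) where

    arc-two : ∀ {k a b} → k ≤ n → a ∈ VH → b ∈ VH → Arc k a b →
      ExactlyTwo col[ ρ , Blk k a , Blk k b ]
    arc-two {k} le = proj₁ (proj₂ (tp k le)) _ _

    record Fan (i u w e f : ℕ) : Set where
      field
        w∈G    : w ∈ VG
        w∉U    : ∀ p → Blk i u p → p ≢ w
        e≢f    : e ≢ f
        x-mono : ∀ {c} → c ∈ ρ x w → c ≡ e
        within : ∀ {p c} → Blk i u p → c ∈ ρ p w → Pair e f c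

    Fan-root : ∀ {i r u w e f} → IsRoot i r u → Fan (suc i) u w e f → Fan i r w e f
    Fan-root root F = record
      { w∈G = w∈G ; w∉U = λ p pB → w∉U p (root⊆Blk root pB) ; e≢f = e≢f
      ; x-mono = x-mono ; within = λ pB → within (root⊆Blk root pB) }
      where open Fan F

    FanAvoids : ℕ → Set
    FanAvoids i = ∀ {u w e f} → i ≤ n → u ∈ VH → IsBrt i u x → Fan i u w e f →
      ∀ {p} → Blk i u p → f ∈ ρ p w → ¬ Pair e f C

    ArcAvoids : ℕ → Set
    ArcAvoids i = ∀ {r y} → i ≤ n → r ∈ VH → IsBrt i r x → y ∈ VH → Arc i r y →
      ∀ {c} → col[ ρ , Blk i r , Blk i y ] c → c ≢ C

    -- At level 0 the block is {x}, which sees w in e only: there is no such f.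
    fan-base : FanAvoids 0
    fan-base _ _ refl F (_ , refl) f∈ _ = e≢f (sym (x-mono f∈))
      where open Fan F

    -- At level 0 arc colours are tree colours of x.
    arc-base : ArcAvoids 0
    arc-base _ _ refl y∈ arc (_ , _ , (_ , refl) , (_ , refl) , _ , c∈) refl =
      C∉tc (_ , y∈ , arc , c∈)

    -- If f occurs inside the root block, use the hypothesis there.  Otherwise
    -- the block RF of its vertex is dominated by the root block R, and if
    -- C ∈ {e, f} both colours of R ▷ RF lie in {e, f}, hence {e, f} is the
    -- colour pair of the arc, which avoids C.
    fan-step : ∀ i → FanAvoids i → ArcAvoids i → FanAvoids (suc i)
    fan-step i fanᵢ arcᵢ {w = w} {e} {f} le _ (r , root , brt-r) F {rf} rfB f∈ =
      cases-¬ inside-root outside-root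
      where
      open Fan F
      le' : i ≤ n
      le' = ≤-trans (n≤1+n i) le
      r∈ : r ∈ VH
      r∈ = proj₁ root

      inside-root : Same i r rf → ¬ Pair e f C
      inside-root s = fanᵢ le' r∈ brt-r (Fan-root root F) (proj₁ rfB , s) f∈

      outside-root : ¬ Same i r rf → ¬ Pair e f C
      outside-root ns C∈ef = covered (arc-two le' r∈ (proj₁ rfB) arc)
        where
        arc : Arc i r rf
        arc = root-arc root rfB ns
        rfRF : Blk i rf rf
        rfRF = self∈Blk i (proj₁ rfB)

        -- With c on p rf (p ∈ R) and g ∈ {e, f} on p w: g = f is excluded by
        -- the hypothesis at level i, so g = e, and the triangle p rf w with
        -- colours c, f, e is not rainbow, whence c ∈ {e, f}.
        third-side : ∀ {p c g} → Blk i r p → c ∈ ρ p rf → g ∈ ρ p w → Pair e f g → Pair e f c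
        third-side pB c∈ g∈ (inj₂ refl) = ⊥-elim (fanᵢ le' r∈ brt-r (Fan-root root F) pB g∈ C∈ef)
        third-side {p} pB c∈ g∈ (inj₁ refl)
          with non-rainbow (VH⊆VG (proj₁ pB)) (VH⊆VG (proj₁ rfB)) w∈G (arc-distinct arc pB rfRF)
                           (w∉U rf rfB) (w∉U p (root⊆Blk root pB)) c∈ f∈ g∈
        ... | inj₁ c≡f = inj₂ c≡f
        ... | inj₂ (inj₁ f≡e) = ⊥-elim (e≢f (sym f≡e))
        ... | inj₂ (inj₂ c≡e) = inj₁ c≡e

        in-ef : ∀ {c} → col[ ρ , Blk i r , Blk i rf ] c → Pair e f c
        in-ef (p , q , pB , qB , p≢q , c∈) =
          let pU = root⊆Blk root pB
              (g , g∈) = colour-exists (VH⊆VG (proj₁ pB)) w∈G (w∉U p pU)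
          in third-side pB (dom-colour arc pB rfRF qB p≢q c∈) g∈ (within pU g∈)

        covered : ExactlyTwo col[ ρ , Blk i r , Blk i rf ] → ⊥
        covered (c₁ , c₂ , c₁≢c₂ , spec) =
          arc-pair-avoids (pair-cover c₁≢c₂ (in-ef col₁) (in-ef col₂) C∈ef)
          where
          col₁ : col[ ρ , Blk i r , Blk i rf ] c₁
          col₁ = proj₂ (spec c₁) (inj₁ refl)
          col₂ : col[ ρ , Blk i r , Blk i rf ] c₂
          col₂ = proj₂ (spec c₂) (inj₂ refl)
          arc-pair-avoids : ¬ Pair c₁ c₂ C
          arc-pair-avoids (inj₁ C≡c₁) = arcᵢ le' r∈ brt-r (proj₁ rfB) arc col₁ (sym C≡c₁)
          arc-pair-avoids (inj₂ C≡c₂) = arcᵢ le' r∈ brt-r (proj₁ rfB) arc col₂ (sym C≡c₂)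

    -- An arc R ▷ Y of M_{i+1} with brt(R) = x carries two colours e₀ ∈ ρ[xy] and f
    -- (y ∈ Y); since R ▷ Y, the vertex y sees R exactly in {e₀, f} and x in e₀
    -- alone, so this is a fan at level i+1.
    arc-step : ∀ i → FanAvoids (suc i) → ArcAvoids (suc i)
    arc-step i fanₛ {r} {y} le r∈ brt-r y∈ arc {c} c∈RY =
      via-partner (two-partner (arc-two le r∈ y∈ arc) (x , y , xR , yY , x≢y , e₀∈))
      where
      xR : Blk (suc i) r x
      xR = brt∈Blk (suc i) r∈ brt-r
      yY : Blk (suc i) y y
      yY = self∈Blk (suc i) y∈
      x≢y : x ≢ y
      x≢y = arc-distinct arc xR yY
      x∉Y : ¬ Same (suc i) x y
      x∉Y s = arc-disjoint arc (y∈ , Same-trans (suc i) (proj₂ xR) s) yY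
      e₀ : ℕ
      e₀ = proj₁ (colour-exists (VH⊆VG (proj₁ xR)) (VH⊆VG y∈) x≢y)
      e₀∈ : e₀ ∈ ρ x y
      e₀∈ = proj₂ (colour-exists (VH⊆VG (proj₁ xR)) (VH⊆VG y∈) x≢y)

      via-partner : ∃[ f ] (e₀ ≢ f × col[ ρ , Blk (suc i) r , Blk (suc i) y ] f ×
                      (∀ z → col[ ρ , Blk (suc i) r , Blk (suc i) y ] z → Pair e₀ f z)) → c ≢ C
      via-partner (f , e₀≢f , (p , q , pR , qY , p≢q , f∈) , exhaust) c≡C =
        fanₛ le r∈ brt-r fan pR (dom-colour arc pR yY qY p≢q f∈)
          (subst (Pair e₀ f) c≡C (exhaust c c∈RY))
        where
        fan : Fan (suc i) r y e₀ f
        fan = record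
          { w∈G = VH⊆VG y∈ ; w∉U = λ p pR → arc-distinct arc pR yY ; e≢f = e₀≢f
          ; x-mono = λ c∈ → mono-across i (proj₁ xR) y∈ x∉Y c∈ e₀∈
          ; within = λ {p} pR c∈ → exhaust _ (p , y , pR , yY , arc-distinct arc pR yY , c∈) }

    fan-and-arc-avoid : ∀ i → FanAvoids i × ArcAvoids i
    fan-and-arc-avoid zero = fan-base , arc-base
    fan-and-arc-avoid (suc i) =
      let (fanᵢ , arcᵢ) = fan-and-arc-avoid i
          fanₛ = fan-step i fanᵢ arcᵢ
      in fanₛ , arc-step i fanₛ

    arc-avoids : ∀ i → ArcAvoids i
    arc-avoids i = proj₂ (fan-and-arc-avoid i)

    module Star (v : ℕ) (v∈G : v ∈ VG) (x-v : col[ ρ , ｛ x ｝ , ｛ v ｝ ] ≐ ｛ C ｝) where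

      x-v-edge : col[ ρ , ｛ x ｝ , ｛ v ｝ ] C
      x-v-edge = proj₂ (x-v C) refl

      x≢v : x ≢ v
      x≢v with x-v-edge
      ... | (_ , _ , refl , refl , x≢v' , _) = x≢v'

      C-at-x : C ∈ ρ x v
      C-at-x with x-v-edge
      ... | (_ , _ , refl , refl , _ , C∈) = C∈

      only-C-at-x : ∀ {c} → c ∈ ρ x v → c ≡ C
      only-C-at-x c∈ = proj₁ (x-v _) (x , v , refl , refl , x≢v , c∈)

      Monochromatic : ℕ → ℕ → Set
      Monochromatic j u = ¬ Blk j u v × (∀ {w c} → Blk j u w → w ≢ v → c ∈ ρ w v → c ≡ C)

      -- Induction along the roots: a vertex of U outside the root block R lies
      -- in a block W dominated by R; a colour c ≠ C on wv, a colour g ≠ c of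
      -- R ▷ W (≠ C by arc-avoids) on some pw, and the colour C of pv
      -- (induction hypothesis) would form a rainbow triangle.
      monochromatic : ∀ j {u} → j ≤ suc n → u ∈ VH → IsBrt j u x → Monochromatic j u
      monochromatic zero _ _ refl =
        (λ { (_ , x≡v) → x≢v x≡v }) , λ { (_ , refl) _ c∈ → only-C-at-x c∈ }
      monochromatic (suc j) {u} le _ (r , root , brt-r) = v∉U , only-C
        where
        le' : j ≤ n
        le' = ≤-pred le
        r∈ : r ∈ VH
        r∈ = proj₁ root
        ih : Monochromatic j r
        ih = monochromatic j (≤-trans (n≤1+n j) le) r∈ brt-r

        C-from-R : ∀ {p} → Blk j r p → p ≢ v → C ∈ ρ p v
        C-from-R pR p≢v =
          let (d , d∈) = colour-exists (VH⊆VG (proj₁ pR)) v∈G p≢v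
          in subst (λ d → d ∈ ρ _ v) (proj₂ ih pR p≢v d∈) d∈

        v∉U : ¬ Blk (suc j) u v
        v∉U vU@(v∈ , _) = outside-root λ s → proj₁ ih (v∈ , s)
          where
          outside-root : ¬ ¬ Same j r v
          outside-root ns = arc-avoids j le' r∈ brt-r v∈ (root-arc root vU ns)
            (x , v , brt∈Blk j r∈ brt-r , self∈Blk j v∈ , x≢v , C-at-x) refl

        only-C : ∀ {w c} → Blk (suc j) u w → w ≢ v → c ∈ ρ w v → c ≡ C
        only-C {w} {c} wU@(w∈ , _) w≢v c∈ = decidable-stable (c ≟ C) λ c≢C →
          outside-root c≢C (λ s → c≢C (proj₂ ih (w∈ , s) w≢v c∈))
          where
          arc : ¬ Same j r w → Arc j r w
          arc = root-arc root wU
          outside-root : c ≢ C → ¬ ¬ Same j r w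
          outside-root c≢C ns with two-other (arc-two le' r∈ w∈ (arc ns)) c
          ... | (g , gRW@(p , q , pR , qW , p≢q , g∈) , g≢c) =
            no-rainbow (VH⊆VG (proj₁ pR)) (VH⊆VG w∈) v∈G p≢w w≢v p≢v
              (dom-colour (arc ns) pR (self∈Blk j w∈) qW p≢q g∈) c∈ (C-from-R pR p≢v)
              g≢c c≢C (arc-avoids j le' r∈ brt-r w∈ (arc ns) gRW)
            where
            p≢w : p ≢ w
            p≢w = arc-distinct (arc ns) pR (self∈Blk j w∈)
            p≢v : p ≢ v
            p≢v refl = proj₁ ih pR

-- Lemma 2.9.
lemma2p9 : (VG : List ℕ) (ρ : Colouring) →
    EdgeColoured VG ρ → Gallai VG ρ → Maximal VG ρ → Reduced VG ρ →
    (VH : List ℕ) → VH ⊆ VG →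
    (n : ℕ) → Levels.TreeProperty ρ VH n →
    (u : ℕ) → u ∈ VH →
    (v : ℕ) → v ∈ VG →
    (C : ℕ) →
    (x : ℕ) → Levels.IsBrt ρ VH (suc n) u x →
    col[ ρ , ｛ x ｝ , ｛ v ｝ ] ≐ ｛ C ｝ →
    ¬ Levels.TC ρ VH (suc n) u C →
    col[ ρ , Levels.Blk ρ VH (suc n) u , ｛ v ｝ ] ≐ ｛ C ｝
lemma2p9 VG ρ EC gal _ _ VH VH⊆VG n tp u u∈ v v∈G C x brt x-v C∉tc c = only-C , C-occurs
  where
  open Proof VG ρ EC gal VH VH⊆VG
  open LevelFacts ρ VH using (brt∈Blk; tc-lift)
  open Avoidance n tp x C (λ t → C∉tc (tc-lift (suc n) brt t))
  open Star v v∈G x-v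

  only-C : col[ ρ , Levels.Blk ρ VH (suc n) u , ｛ v ｝ ] c → c ≡ C
  only-C (w , _ , wU , refl , w≢v , c∈) = proj₂ (monochromatic (suc n) ≤-refl u∈ brt) wU w≢v c∈

  C-occurs : c ≡ C → col[ ρ , Levels.Blk ρ VH (suc n) u , ｛ v ｝ ] c
  C-occurs refl = x , v , brt∈Blk (suc n) u∈ brt , refl , x≢v , C-at-x
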